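{- Let $m$ be odd and $d$ even with $\gcd(d,m)=1$ and $m>d$, and let $t$ be a positive integer. Let $H=(\mathbb{Z}_m;\{1,2,\dots,d-1\})$ be the hypergraph with vertex set $\mathbb{Z}_m$ and edges $\{i,i+1,\dots,i+d-1\}$ (mod $m$), $i\in\mathbb{Z}_m$. Then $t\circ H$ is a minimal non-odd-bipartite hypergraph with $m$ edges, which is $d$-regular and $td$-uniform.
   Context: Given a hypergraph $G$, take $t$ disjoint copies $G^1,\dots,G^t$, where $v^i,e^i$ denote the copies in $G^i$ of a vertex $v$ and an edge $e$; $t\circ G$ has vertex set $\bigcup_i V(G^i)$ and edge set $\{e^1\cup\dots\cup e^t: e\in E(G)\}$. A hypergraph is $k$-uniform if every edge has $k$ vertices and $d$-regular if every vertex lies in exactly $d$ edges. For $k$ even, a $k$-uniform hypergraph $G$ is odd-bipartite if there is a bipartition $\{U,U^c\}$ of $V(G)$ such that every edge meets $U$ (and hence $U^c$) in an odd number of vertices; it is minimal non-odd-bipartite if it is not odd-bipartite but $G-e$ (delete the edge $e$ from the edge set) is odd-bipartite for every edge $e$. -}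

module Defs where

open import Data.Nat using (ℕ; zero; suc; _+_; _*_; _%_; _≟_; pred)
open import Data.Bool using (Bool)
open import Data.Fin using (Fin; toℕ; remQuot; punchIn)
open import Data.Fin.Subset using (Subset; _∩_; ∣_∣)
open import Data.Vec using (tabulate; lookup)
open import Data.List using (upTo)
open import Data.Bool.ListAction using (any)
open import Data.Product using (Σ; proj₂; _×_)
open import Relation.Nullary using (¬_)
open import Relation.Nullary.Decidable using (⌊_⌋)
open import Relation.Binary.PropositionalEquality using (_≡_; _≢_)
open import Function.Definitions using (Injective)

record Hypergraph : Set where
  field
    nV   : ℕ
    nE   : ℕ
    edge : Fin nE → Subset nV
open Hypergraph public

Odd : ℕ → Set
Odd n = n % 2 ≡ 1

Even : ℕ → Set
Even n = n % 2 ≡ 0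

HasEdges : Hypergraph → ℕ → Set
HasEdges G k = (nE G ≡ k) × Injective _≡_ _≡_ (edge G)

Uniform : ℕ → Hypergraph → Set
Uniform k G = ∀ (e : Fin (nE G)) → ∣ edge G e ∣ ≡ k

edgesAt : (G : Hypergraph) → Fin (nV G) → Subset (nE G)
edgesAt G v = tabulate (λ e → lookup (edge G e) v)

Regular : ℕ → Hypergraph → Set
Regular d G = ∀ (v : Fin (nV G)) → ∣ edgesAt G v ∣ ≡ d

OddBipartite : Hypergraph → Set
OddBipartite G = Σ (Subset (nV G)) λ U → ∀ (e : Fin (nE G)) → Odd ∣ edge G e ∩ U ∣

deleteEdge : (G : Hypergraph) → Fin (nE G) → Hypergraph
deleteEdge G e = record
  { nV = nV G
  ; nE = pred (nE G)
  ; edge = del (nE G) (edge G) e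
  }
  where
  del : (n : ℕ) → (Fin n → Subset (nV G)) → Fin n → Fin (pred n) → Subset (nV G)
  del (suc n) f e j = f (punchIn e j)

MinimalNonOddBipartite : Hypergraph → Set
MinimalNonOddBipartite G =
  (¬ OddBipartite G) × (∀ (e : Fin (nE G)) → OddBipartite (deleteEdge G e))

-- t ∘ G : t disjoint copies; vertex (i , v) (copy i of v) is encoded as
-- combine i v : Fin (t * nV G); edge e^1 ∪ ... ∪ e^t contains (i , v) iff v ∈ e.
_∘H_ : ℕ → Hypergraph → Hypergraph
t ∘H G = record
  { nV = t * nV G
  ; nE = nE G
  ; edge = λ e → tabulate (λ x → lookup (edge G e) (proj₂ (remQuot {t} (nV G) x)))
  }

circEdge : (m d : ℕ) → Fin m → Subset m
circEdge (suc k) d i =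
  tabulate (λ v → any (λ j → ⌊ (toℕ i + j) % suc k ≟ toℕ v ⌋) (upTo d))

circulant : ℕ → ℕ → Hypergraph
circulant m d = record { nV = m ; nE = m ; edge = circEdge m d }

module Submission where

-- Incidence counting mod 2 shows that a d-regular hypergraph with d even and an odd
-- number of edges is not odd-bipartite.  For minimality, delete the edge e of the
-- circulant and pick K with K·d ≡ −1 (mod m), which gcd(d, m) = 1 allows; write
-- K·d = (m − 1) + q·m.  Let U be the set of vertices visited an odd number of times
-- by the walk e + d, e + 2d, …, e + K·d.  For any other edge i, |i ∩ U| has the parity
-- of the number of walk points in i = {i, …, i + d − 1}, i.e. of the number of
-- multiples of m crossed by the walk when it is started at e − i ∈ [1, m − 1]; that
-- number is q + 1, and q is even because d is even and m is odd.  Taking t copies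
-- preserves regularity and distinctness of edges, multiplies the edge size by t, and
-- an odd bipartition of G gives one of t ∘ G by placing it on the first copy.

open import Defs
open import Data.Nat using (ℕ; zero; suc; _+_; _*_; _∸_; _%_; _/_; _≤_; _<_; _>_; _≥_; z≤n; s≤s; NonZero)
open import Data.Nat.Properties
open import Data.Nat.DivMod
open import Data.Nat.Divisibility using (divides-refl)
open import Data.Nat.GCD using (gcd; module Bézout)
open import Data.Nat.Coprimality using (coprime-Bézout; gcd≡1⇒coprime)
open import Data.Bool.Base using (Bool; true; false; _∧_; T)
open import Data.Bool.Properties using (∧-zeroʳ)
open import Data.Bool.ListAction using (any)
open import Data.Fin.Base using (Fin; zero; suc; toℕ; fromℕ<; _↑ˡ_; _↑ʳ_; remQuot; punchIn)
open import Data.Fin.Properties using (toℕ<n; toℕ-fromℕ<; toℕ-injective; punchInᵢ≢i; splitAt-↑ʳ; remQuot-combine)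
import Data.Fin.Properties as Fin using (_≟_)
open import Data.Fin.Subset using (Subset; _∩_; ∣_∣)
open import Data.Vec.Base using ([]; _∷_; lookup; tabulate)
open import Data.Vec.Properties using (lookup∘tabulate; tabulate∘lookup; tabulate-cong; lookup-zipWith)
open import Data.List.Base using (upTo)
open import Data.List.Relation.Unary.Any.Properties using (any⁺; any⁻)
open import Data.List.Membership.Propositional using (find; lose)
open import Data.List.Membership.Propositional.Properties using (∈-upTo⁺; ∈-upTo⁻)
open import Data.Product using (_×_; _,_; proj₂; uncurry; ∃-syntax)
open import Data.Sum using (_⊎_; inj₁; inj₂)
open import Function.Base using (_∘_)
open import Function.Definitions using (Injective)
open import Relation.Nullary.Negation using (¬_; contradiction)
open import Relation.Nullary.Decidable using (Dec; does; proof; yes; no; ⌊_⌋; toWitness; fromWitness; dec-true; dec-false)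
open import Relation.Nullary.Reflects using (det; fromEquivalence)
open import Relation.Binary.PropositionalEquality using (_≡_; _≢_; refl; sym; trans; subst; cong; cong₂; module ≡-Reasoning)
open import Algebra.Properties.Semiring.Sum +-*-semiring
  using (sum; sum-syntax; sum-cong-≗; sum-replicate-zero; ∑-comm; *-distribˡ-sum)
open import Algebra.Properties.CommutativeSemigroup +-commutativeSemigroup using (xy∙z≈xz∙y)

open ≡-Reasoning

bit : Bool → ℕ
bit true  = 1
bit false = 0

bit-∧ : ∀ a b → bit (a ∧ b) ≡ bit a * bit b
bit-∧ true  b = sym (+-identityʳ (bit b))
bit-∧ false b = refl

does-≡⇒ : ∀ {a b} {A : Set a} {B : Set b} (a? : Dec A) (b? : Dec B) → does a? ≡ does b? → A → B
does-≡⇒ a? (yes b) _  _ = b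
does-≡⇒ a? (no ¬b) eq a = contradiction (trans (sym (dec-true a? a)) eq) λ ()


∣p∣≡∑bit : ∀ {n} (p : Subset n) → ∣ p ∣ ≡ ∑[ i < n ] bit (lookup p i)
∣p∣≡∑bit []          = refl
∣p∣≡∑bit (true ∷ p)  = cong suc (∣p∣≡∑bit p)
∣p∣≡∑bit (false ∷ p) = ∣p∣≡∑bit p

∣tabulate∣≡∑bit : ∀ {n} (f : Fin n → Bool) → ∣ tabulate f ∣ ≡ ∑[ i < n ] bit (f i)
∣tabulate∣≡∑bit f = trans (∣p∣≡∑bit (tabulate f)) (sum-cong-≗ (cong bit ∘ lookup∘tabulate f))

∣p∩q∣≡∑bit∧ : ∀ {n} (p q : Subset n) → ∣ p ∩ q ∣ ≡ ∑[ i < n ] bit (lookup p i ∧ lookup q i)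
∣p∩q∣≡∑bit∧ p q = trans (∣p∣≡∑bit (p ∩ q)) (sum-cong-≗ (λ i → cong bit (lookup-zipWith _∧_ i p q)))

∑-const : ∀ n c → ∑[ i < n ] c ≡ n * c
∑-const zero    c = refl
∑-const (suc n) c = cong (c +_) (∑-const n c)

∑-%-cong : ∀ {n} p .{{_ : NonZero p}} {f g : Fin n → ℕ} →
           (∀ i → f i % p ≡ g i % p) → sum f % p ≡ sum g % p
∑-%-cong {zero}  p eq = refl
∑-%-cong {suc n} p {f} {g} eq = begin
  (f zero + sum (f ∘ suc)) % p              ≡⟨ %-distribˡ-+ (f zero) _ p ⟩
  (f zero % p + sum (f ∘ suc) % p) % p      ≡⟨ cong₂ (λ a b → (a + b) % p) (eq zero) (∑-%-cong p (eq ∘ suc)) ⟩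
  (g zero % p + sum (g ∘ suc) % p) % p      ≡⟨ %-distribˡ-+ (g zero) _ p ⟨
  (g zero + sum (g ∘ suc)) % p              ∎

∑-pick : ∀ {n} (f : Fin n → ℕ) (w : Fin n) → ∑[ v < n ] (f v * bit (does (w Fin.≟ v))) ≡ f w
∑-pick {suc n} f zero = trans
  (cong₂ _+_ (*-identityʳ (f zero)) (trans (sum-cong-≗ (λ v → *-zeroʳ (f (suc v)))) (sum-replicate-zero n)))
  (+-identityʳ (f zero))
∑-pick {suc n} f (suc w) =
  trans (cong (_+ ∑[ v < n ] (f (suc v) * bit (does (w Fin.≟ v)))) (*-zeroʳ (f zero))) (∑-pick (f ∘ suc) w)

∑-↑ : ∀ a b (g : Fin (a + b) → ℕ) → ∑[ x < a + b ] g x ≡ ∑[ i < a ] g (i ↑ˡ b) + ∑[ j < b ] g (a ↑ʳ j)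
∑-↑ zero    b g = refl
∑-↑ (suc a) b g = trans (cong (g zero +_) (∑-↑ a b (g ∘ suc))) (sym (+-assoc (g zero) _ _))

∑-remQuot : ∀ t n (h : Fin t → Fin n → ℕ) →
            ∑[ x < t * n ] uncurry h (remQuot {t} n x) ≡ ∑[ c < t ] ∑[ v < n ] h c v
∑-remQuot zero    n h = refl
∑-remQuot (suc t) n h = begin
  ∑[ x < n + t * n ] uncurry h (remQuot {suc t} n x)
    ≡⟨ ∑-↑ n (t * n) _ ⟩
  ∑[ v < n ] uncurry h (remQuot {suc t} n (v ↑ˡ t * n)) + ∑[ y < t * n ] uncurry h (remQuot {suc t} n (n ↑ʳ y))
    ≡⟨ cong₂ _+_ (sum-cong-≗ first-copy) (sum-cong-≗ other-copies) ⟩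
  ∑[ v < n ] h zero v + ∑[ y < t * n ] uncurry (h ∘ suc) (remQuot {t} n y)
    ≡⟨ cong (∑[ v < n ] h zero v +_) (∑-remQuot t n (h ∘ suc)) ⟩
  ∑[ v < n ] h zero v + ∑[ c < t ] ∑[ v < n ] h (suc c) v ∎
  where
  first-copy : ∀ v → uncurry h (remQuot {suc t} n (v ↑ˡ t * n)) ≡ h zero v
  first-copy v = cong (uncurry h) (remQuot-combine {suc t} zero v)
  other-copies : ∀ y → uncurry h (remQuot {suc t} n (n ↑ʳ y)) ≡ uncurry (h ∘ suc) (remQuot {t} n y)
  other-copies y rewrite splitAt-↑ʳ n (t * n) y = refl


∑< : ℕ → (ℕ → ℕ) → ℕ
∑< n g = ∑[ i < n ] g (toℕ i)

∑<-cong : ∀ n {g h : ℕ → ℕ} → (∀ x → x < n → g x ≡ h x) → ∑< n g ≡ ∑< n h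
∑<-cong n eq = sum-cong-≗ (λ i → eq (toℕ i) (toℕ<n i))

∑<-suc : ∀ n g → ∑< (suc n) g ≡ ∑< n g + g n
∑<-suc zero    g = +-comm (g 0) 0
∑<-suc (suc n) g = trans (cong (g 0 +_) (∑<-suc n (g ∘ suc))) (sym (+-assoc (g 0) _ _))

∑<-+ : ∀ a b g → ∑< (a + b) g ≡ ∑< a g + ∑< b (λ x → g (a + x))
∑<-+ zero    b g = refl
∑<-+ (suc a) b g = trans (cong (g 0 +_) (∑<-+ a b (g ∘ suc))) (sym (+-assoc (g 0) _ _))

∑<-reverse : ∀ n g → ∑< n g ≡ ∑< n (λ i → g (n ∸ suc i))
∑<-reverse zero    g = refl
∑<-reverse (suc n) g = begin
  ∑< (suc n) g                      ≡⟨ ∑<-suc n g ⟩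
  ∑< n g + g n                      ≡⟨ cong (_+ g n) (∑<-reverse n g) ⟩
  ∑< n (λ i → g (n ∸ suc i)) + g n  ≡⟨ +-comm _ (g n) ⟩
  ∑< (suc n) (λ i → g (suc n ∸ suc i)) ∎

∑<-shift : ∀ n (g : ℕ → ℕ) → g n ≡ g 0 → ∑< n (g ∘ suc) ≡ ∑< n g
∑<-shift zero    g eq = refl
∑<-shift (suc n) g eq = begin
  ∑< (suc n) (g ∘ suc)       ≡⟨ ∑<-suc n (g ∘ suc) ⟩
  ∑< n (g ∘ suc) + g (suc n) ≡⟨ cong (∑< n (g ∘ suc) +_) eq ⟩
  ∑< n (g ∘ suc) + g 0       ≡⟨ +-comm _ (g 0) ⟩
  ∑< (suc n) g               ∎

∑<-rotate : ∀ m .{{_ : NonZero m}} c (f : ℕ → ℕ) → ∑< m (λ v → f ((v + c) % m)) ≡ ∑< m f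
∑<-rotate m zero    f = ∑<-cong m (λ v v<m → cong f (trans (%-congˡ (+-identityʳ v)) (m<n⇒m%n≡m v<m)))
∑<-rotate m (suc c) f = begin
  ∑< m (λ v → f ((v + suc c) % m)) ≡⟨ ∑<-cong m (λ v _ → cong (λ z → f (z % m)) (+-suc v c)) ⟩
  ∑< m (g ∘ suc)                   ≡⟨ ∑<-shift m g (cong f (trans (%-congˡ (+-comm m c)) ([m+n]%n≡m%n c m))) ⟩
  ∑< m g                           ≡⟨ ∑<-rotate m c f ⟩
  ∑< m f                           ∎
  where
  g : ℕ → ℕ
  g y = f ((y + c) % m)

∑<-window : ∀ n d → d ≤ n → ∑< n (λ u → bit (does (u <? d))) ≡ d
∑<-window n d d≤n = begin
  ∑< n χ                                   ≡⟨ cong (λ z → ∑< z χ) (m+[n∸m]≡n d≤n) ⟨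
  ∑< (d + (n ∸ d)) χ                       ≡⟨ ∑<-+ d (n ∸ d) χ ⟩
  ∑< d χ + ∑< (n ∸ d) (λ x → χ (d + x))    ≡⟨ cong₂ _+_ (∑<-cong d inside) (∑<-cong (n ∸ d) outside) ⟩
  ∑[ i < d ] 1 + ∑[ i < n ∸ d ] 0          ≡⟨ cong₂ _+_ (∑-const d 1) (sum-replicate-zero (n ∸ d)) ⟩
  d * 1 + 0                                ≡⟨ trans (+-identityʳ _) (*-identityʳ d) ⟩
  d                                        ∎
  where
  χ : ℕ → ℕ
  χ u = bit (does (u <? d))
  inside : ∀ u → u < d → χ u ≡ 1
  inside u u<d = cong bit (dec-true (u <? d) u<d)
  outside : ∀ x → x < n ∸ d → χ (d + x) ≡ 0
  outside x _ = cong bit (dec-false (d + x <? d) (m+n≮m d x))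


-- Parity

parity : ∀ n → Even n ⊎ Odd n
parity n with n % 2 | m%n<n n 2
... | 0           | _ = inj₁ refl
... | 1           | _ = inj₂ refl
... | suc (suc _) | s≤s (s≤s ())

bit-odd : ∀ c → bit (does (c % 2 ≟ 1)) ≡ c % 2
bit-odd c with parity c
... | inj₁ even rewrite even = refl
... | inj₂ odd  rewrite odd  = refl

odd-suc⇒even : ∀ n → Odd (suc n) → Even n
odd-suc⇒even n odd with parity n
... | inj₁ even = even
... | inj₂ odd-n = contradiction (trans (sym odd) (trans (%-distribˡ-+ 1 n 2) (cong (λ z → (1 + z) % 2) odd-n))) λ ()

even-+-%2 : ∀ {m} n → Even m → (m + n) % 2 ≡ n % 2
even-+-%2 {m} n even = trans (%-distribˡ-+ m n 2) (trans (cong (λ z → (z + n % 2) % 2) even) (m%n%n≡m%n n 2))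

odd-*-%2 : ∀ m {n} → Odd n → (m * n) % 2 ≡ m % 2
odd-*-%2 m {n} odd = begin
  (m * n) % 2               ≡⟨ %-distribˡ-* m n 2 ⟩
  (m % 2 * (n % 2)) % 2     ≡⟨ cong (λ z → (m % 2 * z) % 2) odd ⟩
  (m % 2 * 1) % 2           ≡⟨ %-congˡ (*-identityʳ (m % 2)) ⟩
  m % 2 % 2                 ≡⟨ m%n%n≡m%n m 2 ⟩
  m % 2                     ∎

even-*ʳ : ∀ {m} n → Even m → Even (n * m)
even-*ʳ {m} n even = trans (%-distribˡ-* n m 2) (trans (cong (λ z → (n % 2 * z) % 2) even) (%-congˡ (*-zeroʳ (n % 2))))


[m%n+o]%n≡[m+o]%n : ∀ m o n .{{_ : NonZero n}} → (m % n + o) % n ≡ (m + o) % n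
[m%n+o]%n≡[m+o]%n m o n = begin
  (m % n + o) % n         ≡⟨ %-distribˡ-+ (m % n) o n ⟩
  (m % n % n + o % n) % n ≡⟨ cong (λ z → (z + o % n) % n) (m%n%n≡m%n m n) ⟩
  (m % n + o % n) % n     ≡⟨ %-distribˡ-+ m o n ⟨
  (m + o) % n             ∎

[m+kn]/n≡m/n+k : ∀ m k n .{{_ : NonZero n}} → (m + k * n) / n ≡ m / n + k
[m+kn]/n≡m/n+k m k n = trans (+-distrib-/-∣ʳ m (divides-refl k)) (cong (m / n +_) (m*n/n≡m k n))

m+o≡m%n+o+[m/n]*n : ∀ m o n .{{_ : NonZero n}} → m + o ≡ m % n + o + m / n * n
m+o≡m%n+o+[m/n]*n m o n = begin
  m + o                         ≡⟨ cong (_+ o) (m≡m%n+[m/n]*n m n) ⟩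
  m % n + m / n * n + o         ≡⟨ +-assoc (m % n) _ o ⟩
  m % n + (m / n * n + o)       ≡⟨ cong (m % n +_) (+-comm _ o) ⟩
  m % n + (o + m / n * n)       ≡⟨ +-assoc (m % n) o _ ⟨
  m % n + o + m / n * n         ∎

[m+k]/[1+k]≡1+m/[1+k] : ∀ m k → m % suc k ≢ 0 → (m + k) / suc k ≡ suc (m / suc k)
[m+k]/[1+k]≡1+m/[1+k] m k m%n≢0 = begin
  (m + k) / n                   ≡⟨ /-congˡ (m+o≡m%n+o+[m/n]*n m k n) ⟩
  (r + k + q * n) / n           ≡⟨ [m+kn]/n≡m/n+k (r + k) q n ⟩
  (r + k) / n + q               ≡⟨ cong (_+ q) (m/n≡1+[m∸n]/n n≤r+k) ⟩
  suc ((r + k ∸ n) / n) + q     ≡⟨ cong (λ z → suc z + q) (m<n⇒m/n≡0 r+k∸n<n) ⟩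
  suc q                         ∎
  where
  n : ℕ
  n = suc k
  r : ℕ
  r = m % n
  q : ℕ
  q = m / n
  n≤r+k : n ≤ r + k
  n≤r+k = +-monoˡ-≤ k (n≢0⇒n>0 m%n≢0)
  r+k∸n<n : r + k ∸ n < n
  r+k∸n<n = m<n+o⇒m∸n<o (r + k) n (+-mono-<-≤ (m%n<n m n) (n≤1+n k))

-- v − i in ℤ_m, for i ≤ m
offset : (m : ℕ) .{{_ : NonZero m}} → ℕ → ℕ → ℕ
offset m i v = (v + (m ∸ i)) % m

module _ (m : ℕ) .{{_ : NonZero m}} {i : ℕ} (i<m : i < m) where

  private
    i+[m∸i]≡m : i + (m ∸ i) ≡ m
    i+[m∸i]≡m = m+[n∸m]≡n (<⇒≤ i<m)

  offset-[+]% : ∀ {j} → j < m → offset m i ((i + j) % m) ≡ j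
  offset-[+]% {j} j<m = begin
    ((i + j) % m + (m ∸ i)) % m ≡⟨ [m%n+o]%n≡[m+o]%n (i + j) (m ∸ i) m ⟩
    (i + j + (m ∸ i)) % m       ≡⟨ %-congˡ (cong (_+ (m ∸ i)) (+-comm i j)) ⟩
    (j + i + (m ∸ i)) % m       ≡⟨ %-congˡ (trans (+-assoc j i _) (cong (j +_) i+[m∸i]≡m)) ⟩
    (j + m) % m                 ≡⟨ [m+n]%n≡m%n j m ⟩
    j % m                       ≡⟨ m<n⇒m%n≡m j<m ⟩
    j                           ∎

  [+offset]% : ∀ {v} → v < m → (i + offset m i v) % m ≡ v
  [+offset]% {v} v<m = begin
    (i + (v + (m ∸ i)) % m) % m ≡⟨ %-congˡ (+-comm i _) ⟩
    ((v + (m ∸ i)) % m + i) % m ≡⟨ [m%n+o]%n≡[m+o]%n (v + (m ∸ i)) i m ⟩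
    (v + (m ∸ i) + i) % m       ≡⟨ %-congˡ (trans (+-assoc v _ i) (cong (v +_) (trans (+-comm _ i) i+[m∸i]≡m))) ⟩
    (v + m) % m                 ≡⟨ [m+n]%n≡m%n v m ⟩
    v % m                       ≡⟨ m<n⇒m%n≡m v<m ⟩
    v                           ∎

  offset-self : offset m i i ≡ 0
  offset-self = trans (%-congˡ i+[m∸i]≡m) (n%n≡0 m)

  offset≡0⇒≡ : ∀ {v} → v < m → offset m i v ≡ 0 → i ≡ v
  offset≡0⇒≡ {v} v<m eq = begin
    i                    ≡⟨ m<n⇒m%n≡m i<m ⟨
    i % m                ≡⟨ %-congˡ (+-identityʳ i) ⟨
    (i + 0) % m          ≡⟨ cong (λ z → (i + z) % m) eq ⟨
    (i + offset m i v) % m ≡⟨ [+offset]% v<m ⟩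
    v                    ∎


-- Arithmetic progressions modulo m

-- y / m counts the positive multiples of m up to y; a step of length d ≤ m passes at
-- most one of them, and passes one exactly when it lands on a residue below d.
module _ {m d : ℕ} .{{_ : NonZero m}} (d≤m : d ≤ m) where

  carry : ∀ {r} → r < m → bit (does ((r + d) % m <? d)) ≡ (r + d) / m
  carry {r} r<m with r + d <? m
  ... | yes r+d<m = begin
    bit (does ((r + d) % m <? d)) ≡⟨ cong (λ z → bit (does (z <? d))) (m<n⇒m%n≡m r+d<m) ⟩
    bit (does (r + d <? d))       ≡⟨ cong bit (dec-false (r + d <? d) (m+n≮n r d)) ⟩
    0                             ≡⟨ m<n⇒m/n≡0 r+d<m ⟨
    (r + d) / m                   ∎
  ... | no r+d≮m = begin
    bit (does ((r + d) % m <? d)) ≡⟨ cong (λ z → bit (does (z <? d))) (trans (sym (m≤n⇒[n∸m]%m≡n%m {m} m≤r+d)) (m<n⇒m%n≡m s<m)) ⟩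
    bit (does (s <? d))           ≡⟨ cong bit (dec-true (s <? d) s<d) ⟩
    1                             ≡⟨ cong suc (m<n⇒m/n≡0 s<m) ⟨
    suc (s / m)                   ≡⟨ m/n≡1+[m∸n]/n m≤r+d ⟨
    (r + d) / m                   ∎
    where
    m≤r+d : m ≤ r + d
    m≤r+d = ≮⇒≥ r+d≮m
    s : ℕ
    s = r + d ∸ m
    s<d : s < d
    s<d = subst (s <_) (m+n∸m≡n r d) (∸-monoʳ-< r<m m≤r+d)
    s<m : s < m
    s<m = <-≤-trans s<d d≤m

  [y+d]/m≡y/m+carry : ∀ y → (y + d) / m ≡ y / m + bit (does ((y + d) % m <? d))
  [y+d]/m≡y/m+carry y = begin
    (y + d) / m                                 ≡⟨ /-congˡ (m+o≡m%n+o+[m/n]*n y d m) ⟩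
    (r + d + q * m) / m                         ≡⟨ [m+kn]/n≡m/n+k (r + d) q m ⟩
    (r + d) / m + q                             ≡⟨ cong (_+ q) (carry (m%n<n y m)) ⟨
    bit (does ((r + d) % m <? d)) + q           ≡⟨ cong (λ z → bit (does (z <? d)) + q) y+d≡r+d ⟨
    bit (does ((y + d) % m <? d)) + q           ≡⟨ +-comm _ q ⟩
    q + bit (does ((y + d) % m <? d))           ∎
    where
    r : ℕ
    r = y % m
    q : ℕ
    q = y / m
    y+d≡r+d : (y + d) % m ≡ (r + d) % m
    y+d≡r+d = trans (%-congˡ (m+o≡m%n+o+[m/n]*n y d m)) ([m+kn]%n≡m%n (r + d) q m)

  crossings : ∀ y K → y / m + ∑< K (λ s → bit (does ((y + suc s * d) % m <? d))) ≡ (y + K * d) / m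
  crossings y zero    = trans (+-identityʳ _) (/-congˡ (sym (+-identityʳ y)))
  crossings y (suc K) = begin
    y / m + ∑< (suc K) χ   ≡⟨ cong (y / m +_) (∑<-suc K χ) ⟩
    y / m + (∑< K χ + χ K) ≡⟨ +-assoc (y / m) _ _ ⟨
    y / m + ∑< K χ + χ K   ≡⟨ cong (_+ χ K) (crossings y K) ⟩
    (y + K * d) / m + χ K  ≡⟨ cong (λ z → (y + K * d) / m + bit (does (z % m <? d))) next ⟨
    (y + K * d) / m + bit (does ((y + K * d + d) % m <? d)) ≡⟨ [y+d]/m≡y/m+carry (y + K * d) ⟨
    (y + K * d + d) / m    ≡⟨ /-congˡ next ⟩
    (y + suc K * d) / m    ∎
    where
    χ : ℕ → ℕ
    χ s = bit (does ((y + suc s * d) % m <? d))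
    next : y + K * d + d ≡ y + suc K * d
    next = trans (+-assoc y _ d) (cong (y +_) (+-comm (K * d) d))

walk-crossings : ∀ {k d K q b} → d ≤ suc k → K * d ≡ k + q * suc k → b % suc k ≢ 0 →
  ∑< K (λ s → bit (does ((b + suc s * d) % suc k <? d))) ≡ suc q
walk-crossings {k} {d} {K} {q} {b} d≤m Kd≡k+qm b%m≢0 = +-cancelˡ-≡ (b / m) _ _ (begin
  b / m + ∑< K (λ s → bit (does ((b + suc s * d) % m <? d))) ≡⟨ crossings d≤m b K ⟩
  (b + K * d) / m           ≡⟨ /-congˡ (trans (cong (b +_) Kd≡k+qm) (sym (+-assoc b k _))) ⟩
  (b + k + q * m) / m       ≡⟨ [m+kn]/n≡m/n+k (b + k) q m ⟩
  (b + k) / m + q           ≡⟨ cong (_+ q) ([m+k]/[1+k]≡1+m/[1+k] b k b%m≢0) ⟩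
  suc (b / m) + q           ≡⟨ +-suc (b / m) q ⟨
  b / m + suc q             ∎)
  where
  m : ℕ
  m = suc k

gcd≡1⇒multiple≡-1 : ∀ d k → gcd d (suc k) ≡ 1 → ∃[ K ] ∃[ q ] K * d ≡ k + q * suc k
gcd≡1⇒multiple≡-1 d k gcd≡1 with coprime-Bézout (gcd≡1⇒coprime gcd≡1)
... | Bézout.+- x y eq = k * x , k * y , (begin
  k * x * d           ≡⟨ *-assoc k x d ⟩
  k * (x * d)         ≡⟨ cong (k *_) eq ⟨
  k * (1 + y * suc k) ≡⟨ *-distribˡ-+ k 1 _ ⟩
  k * 1 + k * (y * suc k) ≡⟨ cong₂ _+_ (*-identityʳ k) (sym (*-assoc k y _)) ⟩
  k + k * y * suc k   ∎)
... | Bézout.-+ x zero    ()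
... | Bézout.-+ x (suc y) eq = x , y , suc-injective eq

multiple≡-1⇒even-quotient : ∀ {d k K q} → Even d → Odd (suc k) → K * d ≡ k + q * suc k → Even q
multiple≡-1⇒even-quotient {d} {k} {K} {q} even-d odd-m eq = begin
  q % 2                 ≡⟨ odd-*-%2 q odd-m ⟨
  (q * suc k) % 2       ≡⟨ even-+-%2 {k} (q * suc k) (odd-suc⇒even k odd-m) ⟨
  (k + q * suc k) % 2   ≡⟨ %-congˡ eq ⟨
  (K * d) % 2           ≡⟨ even-*ʳ K even-d ⟩
  0                     ∎


-- Hypergraphs

double-counting : (G : Hypergraph) (U : Subset (nV G)) →
  ∑[ e < nE G ] ∣ edge G e ∩ U ∣ ≡ ∑[ v < nV G ] (bit (lookup U v) * ∣ edgesAt G v ∣)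
double-counting G U = begin
  ∑[ e < nE G ] ∣ edge G e ∩ U ∣
    ≡⟨ sum-cong-≗ incidences ⟩
  ∑[ e < nE G ] ∑[ v < nV G ] (bit (lookup U v) * bit (lookup (edge G e) v))
    ≡⟨ ∑-comm (λ e v → bit (lookup U v) * bit (lookup (edge G e) v)) ⟩
  ∑[ v < nV G ] ∑[ e < nE G ] (bit (lookup U v) * bit (lookup (edge G e) v))
    ≡⟨ sum-cong-≗ (λ v → *-distribˡ-sum (bit (lookup U v)) (λ e → bit (lookup (edge G e) v))) ⟨
  ∑[ v < nV G ] (bit (lookup U v) * ∑[ e < nE G ] bit (lookup (edge G e) v))
    ≡⟨ sum-cong-≗ (λ v → cong (bit (lookup U v) *_) (∣tabulate∣≡∑bit (λ e → lookup (edge G e) v))) ⟨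
  ∑[ v < nV G ] (bit (lookup U v) * ∣ edgesAt G v ∣) ∎
  where
  incidences : ∀ e → ∣ edge G e ∩ U ∣ ≡ ∑[ v < nV G ] (bit (lookup U v) * bit (lookup (edge G e) v))
  incidences e = trans (∣p∩q∣≡∑bit∧ (edge G e) U) (sum-cong-≗ (λ v →
    trans (bit-∧ (lookup (edge G e) v) (lookup U v)) (*-comm (bit (lookup (edge G e) v)) (bit (lookup U v)))))

regular⇒¬oddBipartite : ∀ {d} (G : Hypergraph) → Regular d G → Even d → Odd (nE G) → ¬ OddBipartite G
regular⇒¬oddBipartite {d} G regular even-d odd-nE (U , odd) = contradiction (trans (sym sum-odd) sum-even) λ ()
  where
  sum-odd : (∑[ e < nE G ] ∣ edge G e ∩ U ∣) % 2 ≡ 1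
  sum-odd = begin
    (∑[ e < nE G ] ∣ edge G e ∩ U ∣) % 2 ≡⟨ ∑-%-cong 2 odd ⟩
    (∑[ e < nE G ] 1) % 2                ≡⟨ %-congˡ (trans (∑-const (nE G) 1) (*-identityʳ (nE G))) ⟩
    nE G % 2                             ≡⟨ odd-nE ⟩
    1                                    ∎
  sum-even : (∑[ e < nE G ] ∣ edge G e ∩ U ∣) % 2 ≡ 0
  sum-even = begin
    (∑[ e < nE G ] ∣ edge G e ∩ U ∣) % 2                    ≡⟨ %-congˡ (double-counting G U) ⟩
    (∑[ v < nV G ] (bit (lookup U v) * ∣ edgesAt G v ∣)) % 2 ≡⟨ %-congˡ (sum-cong-≗ (cong (bit (lookup U _) *_) ∘ regular)) ⟩
    (∑[ v < nV G ] (bit (lookup U v) * d)) % 2              ≡⟨ ∑-%-cong 2 (λ v → even-*ʳ (bit (lookup U v)) even-d) ⟩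
    (∑[ v < nV G ] 0) % 2                                   ≡⟨ %-congˡ (sum-replicate-zero (nV G)) ⟩
    0                                                       ∎

module _ (t : ℕ) (G : Hypergraph) where

  lookup-∘H : ∀ e x → lookup (edge (t ∘H G) e) x ≡ lookup (edge G e) (proj₂ (remQuot {t} (nV G) x))
  lookup-∘H e = lookup∘tabulate _

  ∣edge-∘H∣ : ∀ e → ∣ edge (t ∘H G) e ∣ ≡ t * ∣ edge G e ∣
  ∣edge-∘H∣ e = begin
    ∣ edge (t ∘H G) e ∣
      ≡⟨ ∣tabulate∣≡∑bit (λ x → lookup (edge G e) (proj₂ (remQuot {t} (nV G) x))) ⟩
    ∑[ x < t * nV G ] bit (lookup (edge G e) (proj₂ (remQuot {t} (nV G) x)))
      ≡⟨ ∑-remQuot t (nV G) (λ _ v → bit (lookup (edge G e) v)) ⟩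
    ∑[ c < t ] ∑[ v < nV G ] bit (lookup (edge G e) v)
      ≡⟨ sum-cong-≗ {t} (λ _ → ∣p∣≡∑bit (edge G e)) ⟨
    ∑[ c < t ] ∣ edge G e ∣
      ≡⟨ ∑-const t _ ⟩
    t * ∣ edge G e ∣ ∎

  ∘H-uniform : ∀ {k} → Uniform k G → Uniform (t * k) (t ∘H G)
  ∘H-uniform uniform e = trans (∣edge-∘H∣ e) (cong (t *_) (uniform e))

  ∘H-regular : ∀ {d} → Regular d G → Regular d (t ∘H G)
  ∘H-regular regular x = trans (cong ∣_∣ (tabulate-cong (λ e → lookup-∘H e x))) (regular _)

module _ (t : ℕ) (G : Hypergraph) where

  lookup-∘H-↑ˡ : ∀ e v → lookup (edge (suc t ∘H G) e) (v ↑ˡ t * nV G) ≡ lookup (edge G e) v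
  lookup-∘H-↑ˡ e v = trans (lookup-∘H (suc t) G e (v ↑ˡ t * nV G)) (cong (lookup (edge G e) ∘ proj₂) (remQuot-combine zero v))

  ∘H-injective : Injective _≡_ _≡_ (edge G) → Injective _≡_ _≡_ (edge (suc t ∘H G))
  ∘H-injective injective {e} {e′} eq = injective (begin
    edge G e                      ≡⟨ tabulate∘lookup (edge G e) ⟨
    tabulate (lookup (edge G e))  ≡⟨ tabulate-cong first-copy ⟩
    tabulate (lookup (edge G e′)) ≡⟨ tabulate∘lookup (edge G e′) ⟩
    edge G e′                     ∎)
    where
    first-copy : ∀ v → lookup (edge G e) v ≡ lookup (edge G e′) v
    first-copy v = begin
      lookup (edge G e) v                            ≡⟨ lookup-∘H-↑ˡ e v ⟨
      lookup (edge (suc t ∘H G) e) (v ↑ˡ t * nV G)  ≡⟨ cong (λ p → lookup p (v ↑ˡ t * nV G)) eq ⟩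
      lookup (edge (suc t ∘H G) e′) (v ↑ˡ t * nV G) ≡⟨ lookup-∘H-↑ˡ e′ v ⟩
      lookup (edge G e′) v                           ∎

  ∘H-oddBipartite : OddBipartite G → OddBipartite (suc t ∘H G)
  ∘H-oddBipartite (U , odd) = U′ , λ e → subst Odd (sym (∣edge∩U′∣ e)) (odd e)
    where
    U′ : Subset (suc t * nV G)
    U′ = tabulate (λ x → let (c , v) = remQuot {suc t} (nV G) x in does (c Fin.≟ zero) ∧ lookup U v)

    ∣edge∩U′∣ : ∀ e → ∣ edge (suc t ∘H G) e ∩ U′ ∣ ≡ ∣ edge G e ∩ U ∣
    ∣edge∩U′∣ e = begin
      ∣ edge (suc t ∘H G) e ∩ U′ ∣
        ≡⟨ ∣p∩q∣≡∑bit∧ (edge (suc t ∘H G) e) U′ ⟩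
      ∑[ x < suc t * nV G ] bit (lookup (edge (suc t ∘H G) e) x ∧ lookup U′ x)
        ≡⟨ sum-cong-≗ (λ x → cong₂ (λ a b → bit (a ∧ b)) (lookup-∘H (suc t) G e x) (lookup∘tabulate _ x)) ⟩
      ∑[ x < suc t * nV G ] uncurry h (remQuot {suc t} (nV G) x)
        ≡⟨ ∑-remQuot (suc t) (nV G) h ⟩
      ∑[ v < nV G ] h zero v + ∑[ c < t ] ∑[ v < nV G ] h (suc c) v
        ≡⟨ cong₂ _+_ (∣p∩q∣≡∑bit∧ (edge G e) U) other-copies ⟨
      ∣ edge G e ∩ U ∣ + 0
        ≡⟨ +-identityʳ _ ⟩
      ∣ edge G e ∩ U ∣ ∎
      where
      h : Fin (suc t) → Fin (nV G) → ℕ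
      h c v = bit (lookup (edge G e) v ∧ (does (c Fin.≟ zero) ∧ lookup U v))
      other-copies : 0 ≡ ∑[ c < t ] ∑[ v < nV G ] h (suc c) v
      other-copies = sym (trans (sum-cong-≗ {t} (λ c → trans (sum-cong-≗ {nV G} (λ v → cong bit (∧-zeroʳ (lookup (edge G e) v))))
                                                                 (sum-replicate-zero (nV G))))
                                (sum-replicate-zero t))

module _ {n K : ℕ} (w : Fin K → Fin n) where

  hits : Fin n → ℕ
  hits v = ∑[ s < K ] bit (does (w s Fin.≟ v))

  oddHits : Subset n
  oddHits = tabulate (λ v → does (hits v % 2 ≟ 1))

  ∣∩oddHits∣≡∑-%2 : ∀ (A : Subset n) → ∣ A ∩ oddHits ∣ % 2 ≡ (∑[ s < K ] bit (lookup A (w s))) % 2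
  ∣∩oddHits∣≡∑-%2 A = begin
    ∣ A ∩ oddHits ∣ % 2
      ≡⟨ %-congˡ (∣p∩q∣≡∑bit∧ A oddHits) ⟩
    (∑[ v < n ] bit (lookup A v ∧ lookup oddHits v)) % 2
      ≡⟨ ∑-%-cong 2 (λ v → trans (cong (λ b → bit (lookup A v ∧ b) % 2) (lookup∘tabulate _ v)) (parity-of-hits (lookup A v) v)) ⟩
    (∑[ v < n ] (bit (lookup A v) * hits v)) % 2
      ≡⟨ %-congˡ (sum-cong-≗ (λ v → *-distribˡ-sum (bit (lookup A v)) (λ s → bit (does (w s Fin.≟ v))))) ⟩
    (∑[ v < n ] ∑[ s < K ] (bit (lookup A v) * bit (does (w s Fin.≟ v)))) % 2
      ≡⟨ %-congˡ (∑-comm (λ v s → bit (lookup A v) * bit (does (w s Fin.≟ v)))) ⟩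
    (∑[ s < K ] ∑[ v < n ] (bit (lookup A v) * bit (does (w s Fin.≟ v)))) % 2
      ≡⟨ %-congˡ (sum-cong-≗ (λ s → ∑-pick (bit ∘ lookup A) (w s))) ⟩
    (∑[ s < K ] bit (lookup A (w s))) % 2 ∎
    where
    parity-of-hits : ∀ a v → bit (a ∧ does (hits v % 2 ≟ 1)) % 2 ≡ (bit a * hits v) % 2
    parity-of-hits false v = refl
    parity-of-hits true  v = trans (%-congˡ (bit-odd (hits v))) (trans (m%n%n≡m%n (hits v) 2) (%-congˡ (sym (*-identityˡ (hits v)))))


-- The circulant hypergraph

circEdge-lookup : ∀ {k d} → d ≤ suc k → (i v : Fin (suc k)) →
  lookup (circEdge (suc k) d i) v ≡ does (offset (suc k) (toℕ i) (toℕ v) <? d)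
circEdge-lookup {k} {d} d≤m i v =
  trans (lookup∘tabulate (λ w → any (λ j → ⌊ (I + j) % m ≟ toℕ w ⌋) (upTo d)) v)
        (det (fromEquivalence sound complete) (proof (offset m I V <? d)))
  where
  m : ℕ
  m = suc k
  I : ℕ
  I = toℕ i
  V : ℕ
  V = toℕ v
  hit : ℕ → Bool
  hit j = ⌊ (I + j) % m ≟ V ⌋
  sound : T (any hit (upTo d)) → offset m I V < d
  sound h with j , j∈upTo , hit-j ← find (any⁻ hit (upTo d) h) =
    subst (_< d) (sym (trans (cong (offset m I) (sym (toWitness hit-j))) (offset-[+]% m (toℕ<n i) j<m))) j<d
    where
    j<d : j < d
    j<d = ∈-upTo⁻ j∈upTo
    j<m : j < m
    j<m = <-≤-trans j<d d≤m
  complete : offset m I V < d → T (any hit (upTo d))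
  complete lt = any⁺ hit (lose (∈-upTo⁺ lt) (fromWitness ([+offset]% m (toℕ<n i) (toℕ<n v))))

circulant-uniform : ∀ {k d} → d ≤ suc k → Uniform d (circulant (suc k) d)
circulant-uniform {k} {d} d≤m i = begin
  ∣ circEdge m d i ∣                                  ≡⟨ ∣p∣≡∑bit (circEdge m d i) ⟩
  ∑[ v < m ] bit (lookup (circEdge m d i) v)          ≡⟨ sum-cong-≗ (cong bit ∘ circEdge-lookup d≤m i) ⟩
  ∑< m (λ v → bit (does ((v + (m ∸ toℕ i)) % m <? d))) ≡⟨ ∑<-rotate m (m ∸ toℕ i) (λ u → bit (does (u <? d))) ⟩
  ∑< m (λ u → bit (does (u <? d)))                    ≡⟨ ∑<-window m d d≤m ⟩
  d                                                   ∎
  where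
  m : ℕ
  m = suc k

circulant-regular : ∀ {k d} → d ≤ suc k → Regular d (circulant (suc k) d)
circulant-regular {k} {d} d≤m v = begin
  ∣ edgesAt (circulant m d) v ∣                    ≡⟨ ∣tabulate∣≡∑bit (λ i → lookup (circEdge m d i) v) ⟩
  ∑[ i < m ] bit (lookup (circEdge m d i) v)       ≡⟨ sum-cong-≗ (λ i → cong bit (circEdge-lookup d≤m i v)) ⟩
  ∑< m (λ i → χ ((V + (m ∸ i)) % m))               ≡⟨ ∑<-reverse m (λ i → χ ((V + (m ∸ i)) % m)) ⟩
  ∑< m (λ i → χ ((V + (m ∸ (m ∸ suc i))) % m))     ≡⟨ ∑<-cong m (λ i i<m → cong (λ z → χ (z % m)) (reflect i<m)) ⟩
  ∑< m (λ i → χ ((i + suc V) % m))                 ≡⟨ ∑<-rotate m (suc V) χ ⟩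
  ∑< m χ                                           ≡⟨ ∑<-window m d d≤m ⟩
  d                                                ∎
  where
  m : ℕ
  m = suc k
  V : ℕ
  V = toℕ v
  χ : ℕ → ℕ
  χ u = bit (does (u <? d))
  reflect : ∀ {i} → i < m → V + (m ∸ (m ∸ suc i)) ≡ i + suc V
  reflect {i} i<m = trans (cong (V +_) (m∸[m∸n]≡n i<m)) (trans (+-comm V (suc i)) (sym (+-suc i V)))

-- Edge i contains i but not i − 1 = i + k.  If edge i = edge i′, the offset r of i from i′
-- is below d, and r = r′ + 1 would put i − 1 = i′ + r′ into edge i′.
circEdge-injective : ∀ {k d} → 0 < d → d ≤ k → Injective _≡_ _≡_ (circEdge (suc k) d)
circEdge-injective {k} {d} 0<d d≤k {i} {i′} eq = toℕ-injective (sym (offset≡0⇒≡ m (toℕ<n i′) (toℕ<n i) r≡0))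
  where
  m : ℕ
  m = suc k
  I : ℕ
  I = toℕ i
  I′ : ℕ
  I′ = toℕ i′
  d≤m : d ≤ m
  d≤m = ≤-trans d≤k (n≤1+n k)

  same-membership : ∀ {v} → v < m → does (offset m I v <? d) ≡ does (offset m I′ v <? d)
  same-membership {v} v<m = subst (λ z → does (offset m I z <? d) ≡ does (offset m I′ z <? d)) (toℕ-fromℕ< v<m) (begin
    does (offset m I (toℕ w) <? d)  ≡⟨ circEdge-lookup d≤m i w ⟨
    lookup (circEdge m d i) w       ≡⟨ cong (λ e → lookup e w) eq ⟩
    lookup (circEdge m d i′) w      ≡⟨ circEdge-lookup d≤m i′ w ⟩
    does (offset m I′ (toℕ w) <? d) ∎)
    where
    w : Fin m
    w = fromℕ< v<m

  r : ℕ
  r = offset m I′ I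

  r<d : r < d
  r<d = does-≡⇒ (offset m I I <? d) (r <? d) (same-membership (toℕ<n i))
                (subst (_< d) (sym (offset-self m (toℕ<n i))) 0<d)

  r≡0 : r ≡ 0
  r≡0 with r | r<d | [+offset]% m (toℕ<n i′) (toℕ<n i)
  ... | zero   | _     | _       = refl
  ... | suc r′ | r+1<d | I′+r≡I = contradiction d≤k (<⇒≱ k<d)
    where
    pred-I : ℕ
    pred-I = (I + k) % m
    pred-I≡I′+r′ : pred-I ≡ (I′ + r′) % m
    pred-I≡I′+r′ = begin
      (I + k) % m                 ≡⟨ cong (λ z → (z + k) % m) I′+r≡I ⟨
      ((I′ + suc r′) % m + k) % m ≡⟨ [m%n+o]%n≡[m+o]%n (I′ + suc r′) k m ⟩
      (I′ + suc r′ + k) % m       ≡⟨ %-congˡ (trans (+-assoc I′ (suc r′) k) (cong (I′ +_) (sym (+-suc r′ k)))) ⟩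
      (I′ + (r′ + m)) % m         ≡⟨ %-congˡ (+-assoc I′ r′ m) ⟨
      (I′ + r′ + m) % m           ≡⟨ [m+n]%n≡m%n (I′ + r′) m ⟩
      (I′ + r′) % m               ∎
    r′<d : r′ < d
    r′<d = <-trans (n<1+n r′) r+1<d
    pred-I-in-i′ : offset m I′ pred-I < d
    pred-I-in-i′ = subst (_< d)
      (sym (trans (cong (offset m I′) pred-I≡I′+r′) (offset-[+]% m (toℕ<n i′) (<-≤-trans r′<d d≤m)))) r′<d
    k<d : k < d
    k<d = subst (_< d) (offset-[+]% m (toℕ<n i) (n<1+n k))
      (does-≡⇒ (offset m I′ pred-I <? d) (offset m I pred-I <? d) (sym (same-membership (m%n<n (I + k) m))) pred-I-in-i′)

gcd≡1⇒circEdge-injective : ∀ {k d} → gcd d (suc k) ≡ 1 → d ≤ k → Injective _≡_ _≡_ (circEdge (suc k) d)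
gcd≡1⇒circEdge-injective {k}     {suc d} _  d<k = circEdge-injective (s≤s z≤n) d<k
gcd≡1⇒circEdge-injective {zero}  {zero}  _  _   {zero} {zero} _ = refl
gcd≡1⇒circEdge-injective {suc k} {zero}  () _

circulant-minus-edge-oddBipartite : ∀ {k d} → Odd (suc k) → Even d → gcd d (suc k) ≡ 1 → d ≤ suc k →
  (e : Fin (suc k)) → OddBipartite (deleteEdge (circulant (suc k) d) e)
circulant-minus-edge-oddBipartite {k} {d} odd-m even-d gcd≡1 d≤m e
  with K , q , Kd≡k+qm ← gcd≡1⇒multiple≡-1 d k gcd≡1 =
  oddHits walk , λ j → odd-intersection (punchIn e j) (punchInᵢ≢i e j)
  where
  m : ℕ
  m = suc k
  E : ℕ
  E = toℕ e

  walk : Fin K → Fin m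
  walk s = fromℕ< (m%n<n (E + suc (toℕ s) * d) m)

  odd-intersection : ∀ i → i ≢ e → Odd ∣ circEdge m d i ∩ oddHits walk ∣
  odd-intersection i i≢e = begin
    ∣ circEdge m d i ∩ oddHits walk ∣ % 2                    ≡⟨ ∣∩oddHits∣≡∑-%2 walk (circEdge m d i) ⟩
    (∑[ s < K ] bit (lookup (circEdge m d i) (walk s))) % 2  ≡⟨ %-congˡ (sum-cong-≗ (cong bit ∘ walk-in-edge)) ⟩
    (∑< K (λ s → bit (does ((b + suc s * d) % m <? d)))) % 2 ≡⟨ %-congˡ (walk-crossings {K = K} {q} {b} d≤m Kd≡k+qm b%m≢0) ⟩
    suc q % 2                                                ≡⟨ %-distribˡ-+ 1 q 2 ⟩
    (1 + q % 2) % 2                                          ≡⟨ cong (λ z → (1 + z) % 2) (multiple≡-1⇒even-quotient {K = K} {q} even-d odd-m Kd≡k+qm) ⟩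
    1                                                        ∎
    where
    I : ℕ
    I = toℕ i
    b : ℕ
    b = E + (m ∸ I)

    b%m≢0 : b % m ≢ 0
    b%m≢0 = i≢e ∘ toℕ-injective ∘ offset≡0⇒≡ m (toℕ<n i) (toℕ<n e)

    walk-in-edge : ∀ s → lookup (circEdge m d i) (walk s) ≡ does ((b + suc (toℕ s) * d) % m <? d)
    walk-in-edge s = trans (circEdge-lookup d≤m i (walk s)) (cong (λ z → does (z <? d)) (begin
      offset m I (toℕ (walk s))                 ≡⟨ cong (offset m I) (toℕ-fromℕ< (m%n<n (E + suc (toℕ s) * d) m)) ⟩
      ((E + suc (toℕ s) * d) % m + (m ∸ I)) % m ≡⟨ [m%n+o]%n≡[m+o]%n (E + suc (toℕ s) * d) (m ∸ I) m ⟩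
      (E + suc (toℕ s) * d + (m ∸ I)) % m       ≡⟨ %-congˡ (xy∙z≈xz∙y E _ _) ⟩
      (b + suc (toℕ s) * d) % m                 ∎))


corollary4p10 : (m d t : ℕ) → Odd m → Even d → gcd d m ≡ 1 → m > d → t ≥ 1 →
    MinimalNonOddBipartite (t ∘H circulant m d)
      × HasEdges (t ∘H circulant m d) m
      × Regular d (t ∘H circulant m d)
      × Uniform (t * d) (t ∘H circulant m d)
corollary4p10 zero    d t       _     _      _     ()         _
corollary4p10 (suc k) d zero    _     _      _     _          ()
corollary4p10 (suc k) d (suc t) odd-m even-d gcd≡1 (s≤s d≤k) _ =
    ( regular⇒¬oddBipartite (suc t ∘H C) regular even-d odd-m
    , λ e → ∘H-oddBipartite t (deleteEdge C e) (circulant-minus-edge-oddBipartite odd-m even-d gcd≡1 d≤m e) )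
  , (refl , ∘H-injective t C (gcd≡1⇒circEdge-injective gcd≡1 d≤k))
  , regular
  , ∘H-uniform (suc t) C (circulant-uniform d≤m)
  where
  C : Hypergraph
  C = circulant (suc k) d
  d≤m : d ≤ suc k
  d≤m = ≤-trans d≤k (n≤1+n k)
  regular : Regular d (suc t ∘H C)
  regular = ∘H-regular (suc t) C (circulant-regular d≤m)
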